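{- For every positive integer $n$, $$\Phi^{(1)}[a; bq^n, b'; c; x, y] = \Phi^{(1)}[a; b, b'; c; x, y] + \frac{bx(1-a)}{1-c} \sum_{k=1}^n q^{k-1} \Phi^{(1)}[aq; bq^k, b'; cq; x, y],$$ and $$\Phi^{(1)}[a; bq^{ -n}, b'; c; x, y] = \Phi^{(1)}[a; b, b'; c; x, y] - \frac{bx(1-a)}{1-c} \sum_{k=1}^n q^{ -k} \Phi^{(1)}[aq; bq^{1-k}, b'; cq; x, y].$$
   Context: Let $q$ be a complex number with $|q|<1$. For a complex number $z$ and an integer $N\ge 0$, $(z;q)_N=\prod_{j=0}^{N-1}(1-zq^j)$. The $q$-Appell function $\Phi^{(1)}$ is $$\Phi^{(1)}[a; b, b'; c; x, y] = \sum_{m, n \geq 0} \frac{(a; q)_{m+n} (b; q)_m (b'; q)_n}{(q; q)_m (q; q)_n (c; q)_{m+n}} x^m y^n .$$ All identities are understood as identities of power series in $x,y$ (convergent for $|x|,|y|$ sufficiently small), with parameters generic so that no denominator appearing vanishes. -}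

module Defs where

open import Level using (Level; _⊔_) renaming (suc to lsuc)
open import Data.Nat using (ℕ; zero; suc; _∸_) renaming (_+_ to _+ℕ_)
open import Relation.Nullary using (¬_)
open import Algebra.Bundles using (CommutativeRing)

-- A field, presented (as usual in constructive libraries) as a commutative
-- ring with a total inverse operation that is a genuine inverse on nonzero
-- elements, and 1 ≠ 0.  (The complex numbers are an instance.)
record Field (c ℓ : Level) : Set (lsuc (c ⊔ ℓ)) where
  field
    commutativeRing : CommutativeRing c ℓ
  open CommutativeRing commutativeRing public
  field
    _⁻¹      : Carrier → Carrier
    ⁻¹-inverse : ∀ x → ¬ (x ≈ 0#) → x * (x ⁻¹) ≈ 1#
    1≉0      : ¬ (1# ≈ 0#)

module QAppell {c ℓ : Level} (F : Field c ℓ) where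
  open Field F

  infixr 8 _^_
  _^_ : Carrier → ℕ → Carrier
  x ^ zero  = 1#
  x ^ suc n = x * (x ^ n)

  poch : Carrier → Carrier → ℕ → Carrier
  poch z q zero    = 1#
  poch z q (suc N) = poch z q N * (1# - z * (q ^ N))

  -- formal power series in x, y: f m n = coefficient of x^m y^n
  PS : Set c
  PS = ℕ → ℕ → Carrier

  _≋_ : PS → PS → Set ℓ
  f ≋ g = ∀ m n → f m n ≈ g m n

  _⊕_ : PS → PS → PS
  (f ⊕ g) m n = f m n + g m n

  _·_ : Carrier → PS → PS
  (s · f) m n = s * f m n

  xMul : PS → PS
  xMul f zero    n = 0#
  xMul f (suc m) n = f m n

  zeroPS : PS
  zeroPS m n = 0#

  sum1 : ℕ → (ℕ → PS) → PS
  sum1 zero    G = zeroPS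
  sum1 (suc N) G = sum1 N G ⊕ G (suc N)

  Φ1 : (q a b b' cc : Carrier) → PS
  Φ1 q a b b' cc m n =
    poch a q (m +ℕ n) * poch b q m * poch b' q n
      * ((poch q q m * poch q q n * poch cc q (m +ℕ n)) ⁻¹)

module Submission where

-- Write Φ[b] for Φ⁽¹⁾[a; b, b′; c; x, y], Φ↑[b] for Φ⁽¹⁾[aq; b, b′; cq; x, y]
-- and λ(b) = b(1-a)/(1-c).  The whole theorem rests on one contiguous relation
--     Φ[bq] = Φ[b] + λ(b) · x · Φ↑[bq],                                      (★)
-- which is checked coefficientwise: the coefficient of x^0 y^n does not
-- depend on b, and for x^(m+1) y^n it follows from the factorisation
--     (bq;q)_{m+1} = (b;q)_{m+1} + b (1 - q^{m+1}) (bq;q)_m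
-- together with (a;q)_{N+1} = (1-a)(aq;q)_N, (c;q)_{N+1} = (1-c)(cq;q)_N and
-- (q;q)_{m+1} = (q;q)_m (1-q^{m+1}), whose factor 1-q^{m+1} cancels.
-- Applying (★) at b q^k (resp. at b q^{-(k+1)}, solved for the other side)
-- gives a one-step recurrence for k ↦ Φ[b q^{±k}], and a telescoping lemma
-- for power series sums these recurrences into the two stated identities.

open import Defs
open import Level using (Level)
open import Data.Nat using (ℕ; zero; suc; _∸_; _≤_) renaming (_+_ to _+ℕ_)
open import Data.Product using (_×_; _,_)
open import Relation.Nullary using (¬_)
import Algebra.Solver.CommutativeMonoid as CommutativeMonoidSolver
import Algebra.Properties.Ring as RingProperties
import Algebra.Properties.Group as GroupProperties

module QAppellContiguity {c ℓ : Level} (F : Field c ℓ) where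
  open Field F
  open QAppell F
  open import Relation.Binary.Reasoning.Setoid setoid
  open RingProperties ring using (-‿distribˡ-*)
  open GroupProperties +-group using (x≈z//y)
  module MS = CommutativeMonoidSolver *-commutativeMonoid
  open MS using (_⊜_) renaming (_⊕_ to _⊛_)

  Nonzero : Carrier → Set ℓ
  Nonzero x = ¬ (x ≈ 0#)

  nonzero-resp : ∀ {x y} → x ≈ y → Nonzero y → Nonzero x
  nonzero-resp x≈y y≉0 x≈0 = y≉0 (trans (sym x≈y) x≈0)

  inverse-unique : ∀ x y → Nonzero x → x * y ≈ 1# → y ≈ x ⁻¹
  inverse-unique x y x≉0 xy≈1 = begin
    y              ≈⟨ sym (*-identityʳ y) ⟩
    y * 1#         ≈⟨ *-congˡ (sym (⁻¹-inverse x x≉0)) ⟩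
    y * (x * x ⁻¹) ≈⟨ MS.solve 3 (λ X Y Z → (Y ⊛ (X ⊛ Z)) ⊜ ((X ⊛ Y) ⊛ Z)) refl x y (x ⁻¹) ⟩
    (x * y) * x ⁻¹ ≈⟨ *-congʳ xy≈1 ⟩
    1# * x ⁻¹      ≈⟨ *-identityˡ _ ⟩
    x ⁻¹           ∎

  inverse-of-product : ∀ x y → Nonzero x → Nonzero y → (x * y) * (x ⁻¹ * y ⁻¹) ≈ 1#
  inverse-of-product x y x≉0 y≉0 = begin
    (x * y) * (x ⁻¹ * y ⁻¹)
      ≈⟨ MS.solve 4 (λ X Y Z W → ((X ⊛ Y) ⊛ (Z ⊛ W)) ⊜ ((X ⊛ Z) ⊛ (Y ⊛ W))) refl x y (x ⁻¹) (y ⁻¹) ⟩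
    (x * x ⁻¹) * (y * y ⁻¹) ≈⟨ *-cong (⁻¹-inverse x x≉0) (⁻¹-inverse y y≉0) ⟩
    1# * 1#                 ≈⟨ *-identityˡ 1# ⟩
    1#                      ∎

  *-nonzero : ∀ {x y} → Nonzero x → Nonzero y → Nonzero (x * y)
  *-nonzero {x} {y} x≉0 y≉0 xy≈0 = 1≉0 (begin
    1#                      ≈⟨ sym (inverse-of-product x y x≉0 y≉0) ⟩
    (x * y) * (x ⁻¹ * y ⁻¹) ≈⟨ *-congʳ xy≈0 ⟩
    0# * (x ⁻¹ * y ⁻¹)      ≈⟨ zeroˡ _ ⟩
    0#                      ∎)

  ⁻¹-distrib-* : ∀ x y → Nonzero x → Nonzero y → (x * y) ⁻¹ ≈ x ⁻¹ * y ⁻¹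
  ⁻¹-distrib-* x y x≉0 y≉0 =
    sym (inverse-unique (x * y) _ (*-nonzero x≉0 y≉0) (inverse-of-product x y x≉0 y≉0))

  -- The total operation _⁻¹ is only known to respect ≈ on nonzero elements.
  ⁻¹-cong : ∀ {x y} → Nonzero x → x ≈ y → x ⁻¹ ≈ y ⁻¹
  ⁻¹-cong {x} {y} x≉0 x≈y = inverse-unique y (x ⁻¹) (nonzero-resp (sym x≈y) x≉0)
    (trans (*-congʳ (sym x≈y)) (⁻¹-inverse x x≉0))

  cancel-inverse : ∀ x y → Nonzero x → Nonzero y → x * (x * y) ⁻¹ ≈ y ⁻¹
  cancel-inverse x y x≉0 y≉0 = begin
    x * (x * y) ⁻¹      ≈⟨ *-congˡ (⁻¹-distrib-* x y x≉0 y≉0) ⟩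
    x * (x ⁻¹ * y ⁻¹)   ≈⟨ sym (*-assoc _ _ _) ⟩
    (x * x ⁻¹) * y ⁻¹   ≈⟨ *-congʳ (⁻¹-inverse x x≉0) ⟩
    1# * y ⁻¹           ≈⟨ *-identityˡ _ ⟩
    y ⁻¹                ∎

  one-minus-cong : ∀ {x y} → x ≈ y → 1# - x ≈ 1# - y
  one-minus-cong x≈y = +-congˡ (-‿cong x≈y)

  -- 1 - b s = (1 - b) + b (1 - s): the source of the two-term splitting.
  one-minus-product : ∀ b s → 1# - b * s ≈ (1# - b) + b * (1# - s)
  one-minus-product b s = sym (begin
    (1# - b) + b * (1# - s)         ≈⟨ +-congˡ (distribˡ b 1# (- s)) ⟩
    (1# - b) + (b * 1# + b * - s)   ≈⟨ +-congˡ (+-cong (*-identityʳ b) (sym (-‿distribʳ-* b s))) ⟩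
    (1# + - b) + (b + - (b * s))    ≈⟨ +-assoc _ _ _ ⟩
    1# + (- b + (b + - (b * s)))    ≈⟨ +-congˡ (sym (+-assoc _ _ _)) ⟩
    1# + ((- b + b) + - (b * s))    ≈⟨ +-congˡ (+-congʳ (-‿inverseˡ b)) ⟩
    1# + (0# + - (b * s))           ≈⟨ +-congˡ (+-identityˡ _) ⟩
    1# - b * s                      ∎)
    where open RingProperties ring using (-‿distribʳ-*)

  poch-cong : ∀ {z w} q N → z ≈ w → poch z q N ≈ poch w q N
  poch-cong q zero    z≈w = refl
  poch-cong q (suc N) z≈w = *-cong (poch-cong q N z≈w) (one-minus-cong (*-congʳ z≈w))

  poch-shift : ∀ z q N → poch z q (suc N) ≈ (1# - z) * poch (z * q) q N
  poch-shift z q zero = begin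
    1# * (1# - z * 1#) ≈⟨ *-identityˡ _ ⟩
    1# - z * 1#        ≈⟨ one-minus-cong (*-identityʳ z) ⟩
    1# - z             ≈⟨ sym (*-identityʳ _) ⟩
    (1# - z) * 1#      ∎
  poch-shift z q (suc N) = begin
    poch z q (suc N) * (1# - z * (q * q ^ N))
      ≈⟨ *-cong (poch-shift z q N) (one-minus-cong (sym (*-assoc z q (q ^ N)))) ⟩
    ((1# - z) * poch (z * q) q N) * (1# - (z * q) * q ^ N)
      ≈⟨ *-assoc _ _ _ ⟩
    (1# - z) * poch (z * q) q (suc N) ∎

  poch-nonzero : ∀ z q → (∀ j → Nonzero (1# - z * q ^ j)) → ∀ N → Nonzero (poch z q N)
  poch-nonzero z q factors zero    = 1≉0
  poch-nonzero z q factors (suc N) = *-nonzero (poch-nonzero z q factors N) (factors N)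

  poch-split : ∀ b q m →
    poch (b * q) q (suc m) ≈ poch b q (suc m) + (b * (1# - q ^ suc m)) * poch (b * q) q m
  poch-split b q m = begin
    B * (1# - (b * q) * q ^ m)
      ≈⟨ *-congˡ (trans (one-minus-cong (*-assoc b q (q ^ m))) (one-minus-product b (q ^ suc m))) ⟩
    B * ((1# - b) + b * (1# - q ^ suc m))   ≈⟨ distribˡ B _ _ ⟩
    B * (1# - b) + B * (b * (1# - q ^ suc m))
      ≈⟨ +-cong (trans (*-comm B _) (sym (poch-shift b q m))) (*-comm B _) ⟩
    poch b q (suc m) + (b * (1# - q ^ suc m)) * B ∎
    where B = poch (b * q) q m

  ≋-trans : ∀ {f g h} → f ≋ g → g ≋ h → f ≋ h
  ≋-trans f≋g g≋h m n = trans (f≋g m n) (g≋h m n)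

  ⊕-congʳ : ∀ {f f′} g → f ≋ f′ → (f ⊕ g) ≋ (f′ ⊕ g)
  ⊕-congʳ g f≋f′ m n = +-congʳ (f≋f′ m n)

  shift-zero : ∀ s → (s · xMul zeroPS) ≋ zeroPS
  shift-zero s zero    n = zeroʳ s
  shift-zero s (suc m) n = zeroʳ s

  shift-⊕ : ∀ s f g → (s · xMul (f ⊕ g)) ≋ ((s · xMul f) ⊕ (s · xMul g))
  shift-⊕ s f g zero    n = sym (trans (+-congˡ (zeroʳ s)) (+-identityʳ _))
  shift-⊕ s f g (suc m) n = distribˡ s (f m n) (g m n)

  shift-rescale : ∀ {s′ s t g h} → s′ ≈ s * t → g ≋ h → (s′ · xMul g) ≋ (s · xMul (t · h))
  shift-rescale {s′} {s} s′≈st g≋h zero    n = trans (zeroʳ s′) (sym (zeroʳ s))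
  shift-rescale {s′} {s} s′≈st g≋h (suc m) n = trans (*-cong s′≈st (g≋h m n)) (*-assoc s _ _)

  move-term : ∀ {f g h} s → f ≋ (g ⊕ (s · h)) → g ≋ (f ⊕ ((- s) · h))
  move-term {f} {g} {h} s f≋g+sh m n = begin
    g m n                  ≈⟨ x≈z//y (g m n) (s * h m n) (f m n) (sym (f≋g+sh m n)) ⟩
    f m n - s * h m n      ≈⟨ +-congˡ (-‿distribˡ-* s (h m n)) ⟩
    f m n + (- s) * h m n  ∎

  telescope : ∀ (f : ℕ → PS) s (G : ℕ → PS) →
    (∀ k → f (suc k) ≋ (f k ⊕ (s · xMul (G (suc k))))) →
    ∀ n → f n ≋ (f 0 ⊕ (s · xMul (sum1 n G)))
  telescope f s G step zero m j = sym (trans (+-congˡ (shift-zero s m j)) (+-identityʳ _))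
  telescope f s G step (suc n) m j = begin
    f (suc n) m j                        ≈⟨ step n m j ⟩
    f n m j + T (G (suc n))              ≈⟨ +-congʳ (telescope f s G step n m j) ⟩
    (f 0 m j + T (sum1 n G)) + T (G (suc n))   ≈⟨ +-assoc _ _ _ ⟩
    f 0 m j + (T (sum1 n G) + T (G (suc n)))   ≈⟨ +-congˡ (sym (shift-⊕ s (sum1 n G) (G (suc n)) m j)) ⟩
    f 0 m j + T (sum1 (suc n) G)         ∎
    where
      T : PS → Carrier
      T g = (s · xMul g) m j

  Φ1-cong : ∀ q a {b b₁} b′ cc → b ≈ b₁ → Φ1 q a b b′ cc ≋ Φ1 q a b₁ b′ cc
  Φ1-cong q a b′ cc b≈b₁ m n = *-congʳ (*-congʳ (*-congˡ (poch-cong q m b≈b₁)))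

  module Contiguity (q a b′ cc : Carrier)
    (q-factors : ∀ j → Nonzero (1# - q ^ suc j))
    (c-factors : ∀ j → Nonzero (1# - cc * q ^ j)) where

    Φ Φ↑ : Carrier → PS
    Φ  b = Φ1 q a b b′ cc
    Φ↑ b = Φ1 q (a * q) b b′ (cc * q)

    prefactor : Carrier → Carrier
    prefactor b = b * (1# - a) * ((1# - cc) ⁻¹)

    den den↑ : ℕ → ℕ → Carrier
    den  m n = poch q q m * poch q q n * poch cc q (m +ℕ n)
    den↑ m n = poch q q m * poch q q n * poch (cc * q) q (m +ℕ n)

    den↑-nonzero : ∀ m n → Nonzero (den↑ m n)
    den↑-nonzero m n = *-nonzero (*-nonzero (Q m) (Q n))
      (poch-nonzero (cc * q) q
        (λ j → nonzero-resp (one-minus-cong (*-assoc cc q (q ^ j))) (c-factors (suc j))) (m +ℕ n))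
      where Q = poch-nonzero q q q-factors

    1-c-nonzero : Nonzero (1# - cc)
    1-c-nonzero = nonzero-resp (one-minus-cong (sym (*-identityʳ cc))) (c-factors 0)

    den-shift : ∀ m n → (1# - q ^ suc m) * ((1# - cc) * den↑ m n) ≈ den (suc m) n
    den-shift m n = begin
      u * ((1# - cc) * ((Qm * Qn) * C))
        ≈⟨ MS.solve 5 (λ U K M₁ M₂ M₃ → (U ⊛ (K ⊛ ((M₁ ⊛ M₂) ⊛ M₃))) ⊜ (((M₁ ⊛ U) ⊛ M₂) ⊛ (K ⊛ M₃)))
             refl u (1# - cc) Qm Qn C ⟩
      ((Qm * u) * Qn) * ((1# - cc) * C) ≈⟨ *-congˡ (sym (poch-shift cc q (m +ℕ n))) ⟩
      den (suc m) n ∎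
      where
        u = 1# - q ^ suc m
        Qm = poch q q m
        Qn = poch q q n
        C = poch (cc * q) q (m +ℕ n)

    -- The factor 1 - q^{m+1} of (q;q)_{m+1} cancels against the one from poch-split.
    inverse-den-shift : ∀ m n → (1# - q ^ suc m) * den (suc m) n ⁻¹ ≈ (1# - cc) ⁻¹ * den↑ m n ⁻¹
    inverse-den-shift m n = begin
      u * den (suc m) n ⁻¹          ≈⟨ *-congˡ (sym (⁻¹-cong (*-nonzero (q-factors m) rest≉0) (den-shift m n))) ⟩
      u * (u * rest) ⁻¹             ≈⟨ cancel-inverse u rest (q-factors m) rest≉0 ⟩
      rest ⁻¹                       ≈⟨ ⁻¹-distrib-* _ _ 1-c-nonzero (den↑-nonzero m n) ⟩
      (1# - cc) ⁻¹ * den↑ m n ⁻¹    ∎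
      where
        u = 1# - q ^ suc m
        rest = (1# - cc) * den↑ m n
        rest≉0 = *-nonzero 1-c-nonzero (den↑-nonzero m n)

    -- The part of Φ[bq] coming from the second summand of poch-split is λ(b) Φ↑[bq].
    extra-term : ∀ b m n →
      poch a q (suc (m +ℕ n)) * ((b * (1# - q ^ suc m)) * poch (b * q) q m) * poch b′ q n
        * den (suc m) n ⁻¹
      ≈ prefactor b * Φ↑ (b * q) m n
    extra-term b m n = begin
      poch a q (suc N) * ((b * u) * B) * P * W
        ≈⟨ *-congʳ (*-congʳ (*-congʳ (poch-shift a q N))) ⟩
      ((1# - a) * A) * ((b * u) * B) * P * W
        ≈⟨ MS.solve 7 (λ V A′ b′′ U B′ P′ W′ → ((((V ⊛ A′) ⊛ ((b′′ ⊛ U) ⊛ B′)) ⊛ P′) ⊛ W′)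
                                            ⊜ ((b′′ ⊛ V) ⊛ (((A′ ⊛ B′) ⊛ P′) ⊛ (U ⊛ W′))))
             refl (1# - a) A b u B P W ⟩
      (b * (1# - a)) * ((A * B * P) * (u * W))
        ≈⟨ *-congˡ (*-congˡ (inverse-den-shift m n)) ⟩
      (b * (1# - a)) * ((A * B * P) * ((1# - cc) ⁻¹ * den↑ m n ⁻¹))
        ≈⟨ MS.solve 4 (λ V X K E → (V ⊛ (X ⊛ (K ⊛ E))) ⊜ ((V ⊛ K) ⊛ (X ⊛ E)))
             refl (b * (1# - a)) (A * B * P) ((1# - cc) ⁻¹) (den↑ m n ⁻¹) ⟩
      prefactor b * Φ↑ (b * q) m n ∎
      where
        N = m +ℕ n
        u = 1# - q ^ suc m
        A = poch (a * q) q N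
        B = poch (b * q) q m
        P = poch b′ q n
        W = den (suc m) n ⁻¹

    contiguity-coefficient : ∀ b m n →
      Φ (b * q) (suc m) n ≈ Φ b (suc m) n + prefactor b * Φ↑ (b * q) m n
    contiguity-coefficient b m n = begin
      A * poch (b * q) q (suc m) * P * W  ≈⟨ *-congʳ (*-congʳ (*-congˡ (poch-split b q m))) ⟩
      A * (Bb + Y) * P * W                ≈⟨ *-congʳ (*-congʳ (distribˡ A Bb Y)) ⟩
      (A * Bb + A * Y) * P * W            ≈⟨ *-congʳ (distribʳ P _ _) ⟩
      (A * Bb * P + A * Y * P) * W        ≈⟨ distribʳ W _ _ ⟩
      A * Bb * P * W + A * Y * P * W      ≈⟨ +-congˡ (extra-term b m n) ⟩
      Φ b (suc m) n + prefactor b * Φ↑ (b * q) m n ∎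
      where
        A = poch a q (suc (m +ℕ n))
        Bb = poch b q (suc m)
        Y = (b * (1# - q ^ suc m)) * poch (b * q) q m
        P = poch b′ q n
        W = den (suc m) n ⁻¹

    -- (★): Φ[bq] = Φ[b] + λ(b) x Φ↑[bq].  For m = 0 both sides agree since
    -- (b;q)_0 = 1 makes the x^0 coefficients independent of b.
    contiguity : ∀ b → Φ (b * q) ≋ (Φ b ⊕ (prefactor b · xMul (Φ↑ (b * q))))
    contiguity b zero    n = sym (trans (+-congˡ (zeroʳ _)) (+-identityʳ _))
    contiguity b (suc m) n = contiguity-coefficient b m n

    contiguity-rescaled : ∀ b t u → b * t * q ≈ u →
      Φ u ≋ (Φ (b * t) ⊕ (prefactor b · xMul (t · Φ↑ u)))
    contiguity-rescaled b t u btq≈u = ≋-trans (Φ1-cong q a b′ cc (sym btq≈u))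
      (≋-trans (contiguity (b * t)) λ m n → +-congˡ
        (shift-rescale prefactor-rescale (Φ1-cong q (a * q) b′ (cc * q) btq≈u) m n))
      where
        prefactor-rescale : prefactor (b * t) ≈ prefactor b * t
        prefactor-rescale = MS.solve 4 (λ B T V K → (((B ⊛ T) ⊛ V) ⊛ K) ⊜ (((B ⊛ V) ⊛ K) ⊛ T))
          refl b t (1# - a) ((1# - cc) ⁻¹)

    ascending : ∀ b n →
      Φ (b * q ^ n) ≋ (Φ b ⊕ (prefactor b · xMul (sum1 n (λ k → (q ^ (k ∸ 1)) · Φ↑ (b * q ^ k)))))
    ascending b n = ≋-trans (telescope (λ k → Φ (b * q ^ k)) (prefactor b) _ step n)
                            (⊕-congʳ _ (Φ1-cong q a b′ cc (*-identityʳ b)))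
      where
        step : ∀ k → Φ (b * q ^ suc k) ≋ (Φ (b * q ^ k) ⊕ (prefactor b · xMul ((q ^ k) · Φ↑ (b * q ^ suc k))))
        step k = contiguity-rescaled b (q ^ k) (b * q ^ suc k)
          (MS.solve 3 (λ B T Q → ((B ⊛ T) ⊛ Q) ⊜ (B ⊛ (Q ⊛ T))) refl b (q ^ k) q)

    -- Second identity: shifting b down by q^n, using (★) at b q^{-(k+1)}
    -- solved for Φ[b q^{-(k+1)}].
    descending : Nonzero q → ∀ b n →
      Φ (b * (q ⁻¹) ^ n)
        ≋ (Φ b ⊕ ((- prefactor b) · xMul (sum1 n (λ k → ((q ⁻¹) ^ k) · Φ↑ (b * (q ⁻¹) ^ (k ∸ 1))))))
    descending q≉0 b n = ≋-trans (telescope (λ k → Φ (b * r ^ k)) (- prefactor b) _ step n)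
                                 (⊕-congʳ _ (Φ1-cong q a b′ cc (*-identityʳ b)))
      where
        r = q ⁻¹
        step : ∀ k → Φ (b * r ^ suc k) ≋ (Φ (b * r ^ k) ⊕ ((- prefactor b) · xMul ((r ^ suc k) · Φ↑ (b * r ^ k))))
        step k = move-term (prefactor b) (contiguity-rescaled b (r ^ suc k) (b * r ^ k) (begin
          b * (r * r ^ k) * q   ≈⟨ MS.solve 4 (λ B R T Q → ((B ⊛ (R ⊛ T)) ⊛ Q) ⊜ ((B ⊛ T) ⊛ (Q ⊛ R))) refl b r (r ^ k) q ⟩
          (b * r ^ k) * (q * r) ≈⟨ *-congˡ (⁻¹-inverse q q≉0) ⟩
          (b * r ^ k) * 1#      ≈⟨ *-identityʳ _ ⟩
          b * r ^ k             ∎))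

theorem3 : ∀ {c ℓ : Level} (F : Field c ℓ) →
    let open Field F in let open QAppell F in
    ∀ (q a b b′ cc : Carrier) →
    ¬ (q ≈ 0#) →
    (∀ j → ¬ (1# - q ^ suc j ≈ 0#)) →
    (∀ j → ¬ (1# - cc * q ^ j ≈ 0#)) →
    ∀ (n : ℕ) → 1 ≤ n →
      (Φ1 q a (b * q ^ n) b′ cc
        ≋ (Φ1 q a b b′ cc
           ⊕ ((b * (1# - a) * ((1# - cc) ⁻¹))
              · xMul (sum1 n (λ k → (q ^ (k ∸ 1)) · Φ1 q (a * q) (b * q ^ k) b′ (cc * q))))))
      ×
      (Φ1 q a (b * (q ⁻¹) ^ n) b′ cc
        ≋ (Φ1 q a b b′ cc
           ⊕ ((- (b * (1# - a) * ((1# - cc) ⁻¹)))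
              · xMul (sum1 n (λ k → ((q ⁻¹) ^ k) · Φ1 q (a * q) (b * (q ⁻¹) ^ (k ∸ 1)) b′ (cc * q))))))
-- The identities hold for every n, including n = 0 where both sums are empty.
theorem3 F q a b b′ cc q≉0 q-factors c-factors n _ = ascending b n , descending q≉0 b n
  where open QAppellContiguity.Contiguity F q a b′ cc q-factors c-factors
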